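{- Let $n\ge 1$ and $0\le m\le n$. Then $P_{n,m}(x)=x^nP_{n,n-m}(1/x)$, where $P_{n,m}(x)=\sum_{k=0}^{n}p_{n,m,k}x^k$. Equivalently, $p_{n,m,k}=p_{n,n-m,n-k}$ for all $k$.
   Context: A Dyck path of semilength $n\ge 0$ is a lattice path in $\mathbb{Z}\times\mathbb{Z}$ from $(0,0)$ to $(2n,0)$ using up steps $U=(1,1)$ and down steps $D=(1,-1)$; it is allowed to go below the $x$-axis. Write it as a word $P_1P_2\cdots P_{2n}$ over $\{U,D\}$. An up step is under the $x$-axis if it goes from height $-h$ to height $-h+1$ for some $h\ge 1$. A Dyck path is $(n,m)$-flawed if it has semilength $n$ and exactly $m$ up steps under the $x$-axis. A peak is a position $i$ with $P_iP_{i+1}=UD$. Let $p_{n,m,k}$ be the number of $(n,m)$-flawed paths with exactly $k$ peaks. -}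

module Defs where

open import Data.Nat using (ℕ; zero; suc; _+_)
open import Data.Integer using (ℤ; +_; -[1+_]) renaming (_+_ to _+ℤ_)
open import Data.List using (List; []; _∷_; map; _++_; length; filter)
open import Data.Bool using (Bool; true; false; _∧_)
open import Relation.Binary.PropositionalEquality using (_≡_)

data Step : Set where
  U D : Step

words : ℕ → List (List Step)
words zero = [] ∷ []
words (suc l) = map (U ∷_) (words l) ++ map (D ∷_) (words l)

δ : Step → ℤ
δ U = + 1
δ D = -[1+ 0 ]

endHeight : ℤ → List Step → ℤ
endHeight h [] = h
endHeight h (s ∷ w) = endHeight (h +ℤ δ s) w

returnsToZero : List Step → Bool
returnsToZero w with endHeight (+ 0) w
... | + zero = true
... | _ = false

-- Number of up steps under the x-axis, i.e. up steps from height -h to -h+1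
-- with h ≥ 1 (equivalently: up steps starting at a negative height),
-- for a path currently at height h.
underUps : ℤ → List Step → ℕ
underUps h [] = 0
underUps -[1+ k ] (U ∷ w) = suc (underUps (-[1+ k ] +ℤ + 1) w)
underUps (+ k) (U ∷ w) = underUps (+ k +ℤ + 1) w
underUps h (D ∷ w) = underUps (h +ℤ -[1+ 0 ]) w

peaks : List Step → ℕ
peaks [] = 0
peaks (U ∷ D ∷ w) = suc (peaks (D ∷ w))
peaks (_ ∷ w) = peaks w

open import Data.Nat using (_≟_)
open import Relation.Nullary.Decidable using (⌊_⌋)

-- Dyck paths (possibly going below the axis) of semilength n:
-- words of length 2n ending at height 0.
dyckPaths : ℕ → List (List Step)
dyckPaths n = filter (λ w → returnsToZero w ≡? true) (words (n + n))
  where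
  open import Data.Bool.Properties using () renaming (_≟_ to _≡?_)

p : ℕ → ℕ → ℕ → ℕ
p n m k = length (filter (λ w → (underUps (+ 0) w ≟ m)) (filter (λ w → peaks w ≟ k) (dyckPaths n)))

module Submission where

open import Defs
open import Algebra.Properties.CommutativeSemigroup using (interchange)
open import Data.Bool using (Bool; true; false; _∧_; not)
open import Data.Bool.Properties using (not-involutive; ∧-zeroʳ; ∧-identityʳ) renaming (_≟_ to _≟ᵇ_)
open import Data.Empty using (⊥)
open import Data.Integer using (ℤ; +_; -[1+_]; -_; _⊖_) renaming (_+_ to _+ℤ_)
import Data.Integer.Properties as ℤ
open import Data.List using (List; []; _∷_; map; _++_; length; filter)
open import Data.List.Properties using (length-map; length-++; ++-assoc; ∷-injectiveʳ)
open import Data.List.Membership.Propositional using (_∈_)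
open import Data.List.Membership.Propositional.Properties
  using (∈-map⁺; ∈-map⁻; ∈-++⁺ˡ; ∈-++⁺ʳ; ∈-++⁻; ∈-filter⁺; ∈-filter⁻)
open import Data.List.Membership.Propositional.Properties.WithK using (unique∧set⇒bag)
open import Data.List.Relation.Binary.BagAndSetEquality using (∼bag⇒↭)
open import Data.List.Relation.Binary.Permutation.Propositional.Properties using (↭-length)
open import Data.List.Relation.Unary.All using ([])
open import Data.List.Relation.Unary.Any using (here)
open import Data.List.Relation.Unary.Unique.Propositional using (Unique; []; _∷_)
import Data.List.Relation.Unary.Unique.Propositional.Properties as Unique
open import Data.Nat using (ℕ; zero; suc; _+_; _∸_; _≤_; _≟_)
open import Data.Nat.Properties
  using ( +-commutativeSemigroup; +-identityʳ; +-comm; +-assoc; +-suc; suc-injective; +-cancelʳ-≡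
        ; m+n∸n≡m; m∸[m∸n]≡n)
open import Data.Product using (_×_; _,_; proj₁; proj₂)
open import Data.Sum using (inj₁; inj₂)
open import Data.Unit using (⊤; tt)
open import Function.Bundles using (mk⇔)
open import Relation.Binary.PropositionalEquality
  using (_≡_; refl; sym; trans; cong; cong₂; subst; subst₂; module ≡-Reasoning)
open import Relation.Nullary using (yes; no; ¬_; contradiction)

-- A path is recorded by two bit strings: for each up step, whether it starts a peak, and for
-- each down step, whether it ends one. Runs of up and down steps alternate, so every pair of
-- strings with equally many ones encodes exactly one word. For a path of semilength n both
-- strings have length n, and complementing both of them is an involution on such paths. It
-- turns k peaks into n - k, and m under-axis up steps into n - m, because whether the i-th up
-- step is under the axis is decided by a comparison of the two strings' prefixes that
-- complementation reverses.

bit : Bool → ℕ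
bit true  = 1
bit false = 0

trues : List Bool → ℕ
trues []       = 0
trues (b ∷ bs) = bit b + trues bs

trues-∷ʳ : ∀ bs b → trues (bs ++ b ∷ []) ≡ trues bs + bit b
trues-∷ʳ []       b = +-identityʳ (bit b)
trues-∷ʳ (c ∷ bs) b = trans (cong (_+_ (bit c)) (trues-∷ʳ bs b)) (sym (+-assoc (bit c) (trues bs) (bit b)))

trues-map-not : ∀ bs → trues (map not bs) + trues bs ≡ length bs
trues-map-not []           = refl
trues-map-not (true ∷ bs)  = trans (+-suc (trues (map not bs)) (trues bs)) (cong suc (trues-map-not bs))
trues-map-not (false ∷ bs) = cong suc (trues-map-not bs)

map-not-involutive : ∀ bs → map not (map not bs) ≡ bs
map-not-involutive []       = refl
map-not-involutive (b ∷ bs) = cong₂ _∷_ (not-involutive b) (map-not-involutive bs)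

startsWithD : List Step → Bool
startsWithD (D ∷ _) = true
startsWithD _       = false

upMarks : List Step → List Bool
upMarks []      = []
upMarks (U ∷ w) = startsWithD w ∷ upMarks w
upMarks (D ∷ w) = upMarks w

-- The flag tells whether the step before w was U.
downMarks : Bool → List Step → List Bool
downMarks _      []      = []
downMarks _      (U ∷ w) = downMarks true w
downMarks afterU (D ∷ w) = afterU ∷ downMarks false w

peaks≡trues-upMarks : ∀ w → peaks w ≡ trues (upMarks w)
peaks≡trues-upMarks []          = refl
peaks≡trues-upMarks (U ∷ [])    = refl
peaks≡trues-upMarks (U ∷ U ∷ w) = peaks≡trues-upMarks (U ∷ w)
peaks≡trues-upMarks (U ∷ D ∷ w) = cong suc (peaks≡trues-upMarks (D ∷ w))
peaks≡trues-upMarks (D ∷ w)     = peaks≡trues-upMarks w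

trues-downMarks : ∀ afterU w → trues (downMarks afterU w) ≡ bit (afterU ∧ startsWithD w) + trues (upMarks w)
trues-downMarks afterU []      rewrite ∧-zeroʳ afterU = refl
trues-downMarks afterU (U ∷ w) rewrite ∧-zeroʳ afterU = trues-downMarks true w
trues-downMarks afterU (D ∷ w) rewrite ∧-identityʳ afterU  = cong (_+_ (bit afterU)) (trues-downMarks false w)

trues-upMarks≡trues-downMarks : ∀ w → trues (upMarks w) ≡ trues (downMarks false w)
trues-upMarks≡trues-downMarks w = sym (trues-downMarks false w)

length-downMarks : ∀ afterU w → length (downMarks afterU w) ≡ length (downMarks false w)
length-downMarks _ []      = refl
length-downMarks _ (U ∷ w) = refl
length-downMarks _ (D ∷ w) = refl

length≡length-upMarks+length-downMarks : ∀ afterU w → length w ≡ length (upMarks w) + length (downMarks afterU w)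
length≡length-upMarks+length-downMarks _ []      = refl
length≡length-upMarks+length-downMarks _ (U ∷ w) = cong suc (length≡length-upMarks+length-downMarks true w)
length≡length-upMarks+length-downMarks _ (D ∷ w) =
  trans (cong suc (length≡length-upMarks+length-downMarks false w)) (sym (+-suc (length (upMarks w)) _))

-- On pairs with different numbers of ones, which encode no word, the output is junk.
mutual
  decode : List Bool → List Bool → List Step
  decode ss (false ∷ ts) = D ∷ decode ss ts
  decode ss ts           = decodeUps ss ts

  decodeUps : List Bool → List Bool → List Step
  decodeUps []           _  = []
  decodeUps (false ∷ ss) ts = U ∷ decodeUps ss ts
  decodeUps (true ∷ ss)  ts = U ∷ decodePeakDown ss ts

  decodePeakDown : List Bool → List Bool → List Step
  decodePeakDown ss (_ ∷ ts) = D ∷ decode ss ts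
  decodePeakDown _  []       = []

NoLeadingFalse : List Bool → Set
NoLeadingFalse (false ∷ _) = ⊥
NoLeadingFalse _           = ⊤

noLeadingFalse-downMarks-afterU : ∀ w → NoLeadingFalse (downMarks true w)
noLeadingFalse-downMarks-afterU []      = tt
noLeadingFalse-downMarks-afterU (U ∷ w) = noLeadingFalse-downMarks-afterU w
noLeadingFalse-downMarks-afterU (D ∷ w) = tt

decode≡decodeUps : ∀ ss ts → NoLeadingFalse ts → decode ss ts ≡ decodeUps ss ts
decode≡decodeUps ss []         _ = refl
decode≡decodeUps ss (true ∷ _) _ = refl

mutual
  decode-marks : ∀ w → decode (upMarks w) (downMarks false w) ≡ w
  decode-marks []      = refl
  decode-marks (D ∷ w) = cong (D ∷_) (decode-marks w)
  decode-marks (U ∷ w) =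
    trans (decode≡decodeUps (upMarks (U ∷ w)) (downMarks true w) (noLeadingFalse-downMarks-afterU w))
          (decodeUps-marks w)

  decodeUps-marks : ∀ w → decodeUps (startsWithD w ∷ upMarks w) (downMarks true w) ≡ U ∷ w
  decodeUps-marks []      = refl
  decodeUps-marks (U ∷ w) = cong (U ∷_) (decodeUps-marks w)
  decodeUps-marks (D ∷ w) = cong (λ v → U ∷ D ∷ v) (decode-marks w)

startsWithD-decodeUps : ∀ ss ts → trues ss ≡ trues ts → NoLeadingFalse ts → startsWithD (decodeUps ss ts) ≡ false
startsWithD-decodeUps []          []         _  _ = refl
startsWithD-decodeUps []          (true ∷ _) () _
startsWithD-decodeUps (false ∷ _) _          _  _ = refl
startsWithD-decodeUps (true ∷ _)  _          _  _ = refl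

mutual
  marks-decode : ∀ ss ts → trues ss ≡ trues ts →
                 upMarks (decode ss ts) ≡ ss × downMarks false (decode ss ts) ≡ ts
  marks-decode ss           (false ∷ ts) e = proj₁ (marks-decode ss ts e) , cong (false ∷_) (proj₂ (marks-decode ss ts e))
  marks-decode []           []           e = refl , refl
  marks-decode []           (true ∷ _)   ()
  marks-decode (true ∷ _)   []           ()
  marks-decode (false ∷ ss) []           e = marks-decodeUps (false ∷ ss) [] e tt
  marks-decode (false ∷ ss) (true ∷ ts)  e = marks-decodeUps (false ∷ ss) (true ∷ ts) e tt
  marks-decode (true ∷ ss)  (true ∷ ts)  e = marks-decodeUps (true ∷ ss) (true ∷ ts) e tt

  marks-decodeUps : ∀ ss ts → trues ss ≡ trues ts → NoLeadingFalse ts →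
                    upMarks (decodeUps ss ts) ≡ ss × downMarks true (decodeUps ss ts) ≡ ts
  marks-decodeUps []           []          _  _ = refl , refl
  marks-decodeUps []           (true ∷ _)  () _
  marks-decodeUps (false ∷ ss) ts          e  h =
    cong₂ _∷_ (startsWithD-decodeUps ss ts e h) (proj₁ (marks-decodeUps ss ts e h)) , proj₂ (marks-decodeUps ss ts e h)
  marks-decodeUps (true ∷ ss)  (true ∷ ts) e  _ =
    let ups≡ , downs≡ = marks-decode ss ts (suc-injective e) in cong (true ∷_) ups≡ , cong (true ∷_) downs≡
  marks-decodeUps (true ∷ _)   []          () _

netRise : List Step → ℤ
netRise w = length (upMarks w) ⊖ length (downMarks false w)

endHeight≡ : ∀ h w → endHeight h w ≡ h +ℤ netRise w
endHeight≡ h [] = sym (ℤ.+-identityʳ h)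
endHeight≡ h (U ∷ w) = begin
  endHeight (h +ℤ + 1) w              ≡⟨ endHeight≡ (h +ℤ + 1) w ⟩
  h +ℤ + 1 +ℤ (ups ⊖ downs)           ≡⟨ ℤ.+-assoc h (+ 1) (ups ⊖ downs) ⟩
  h +ℤ (+ 1 +ℤ (ups ⊖ downs))         ≡⟨ cong (h +ℤ_) (ℤ.distribʳ-⊖-+-pos 1 ups downs) ⟩
  h +ℤ (suc ups ⊖ downs)              ≡⟨ cong (λ d → h +ℤ (suc ups ⊖ d)) (length-downMarks true w) ⟨
  h +ℤ (suc ups ⊖ length (downMarks true w)) ∎
  where
  open ≡-Reasoning
  ups   = length (upMarks w)
  downs = length (downMarks false w)
endHeight≡ h (D ∷ w) = begin
  endHeight (h +ℤ -[1+ 0 ]) w         ≡⟨ endHeight≡ (h +ℤ -[1+ 0 ]) w ⟩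
  h +ℤ -[1+ 0 ] +ℤ (ups ⊖ downs)      ≡⟨ ℤ.+-assoc h -[1+ 0 ] (ups ⊖ downs) ⟩
  h +ℤ (-[1+ 0 ] +ℤ (ups ⊖ downs))    ≡⟨ cong (h +ℤ_) (ℤ.distribʳ-⊖-+-neg 0 ups downs) ⟩
  h +ℤ (ups ⊖ suc downs)              ∎
  where
  open ≡-Reasoning
  ups   = length (upMarks w)
  downs = length (downMarks false w)

returnsToZero⇔netRise≡0 : ∀ w →
  (returnsToZero w ≡ true → netRise w ≡ + 0) × (netRise w ≡ + 0 → returnsToZero w ≡ true)
returnsToZero⇔netRise≡0 w rewrite sym (ℤ.+-identityˡ (netRise w)) | sym (endHeight≡ (+ 0) w) = to , from
  where
  to : returnsToZero w ≡ true → endHeight (+ 0) w ≡ + 0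
  to r with endHeight (+ 0) w
  to r  | + zero   = refl
  to () | + suc _
  to () | -[1+ _ ]

  from : endHeight (+ 0) w ≡ + 0 → returnsToZero w ≡ true
  from e with endHeight (+ 0) w
  from refl | .(+ 0) = refl

Balanced : List Step → Set
Balanced w = length (upMarks w) ≡ length (downMarks false w)

returnsToZero⇒Balanced : ∀ w → returnsToZero w ≡ true → Balanced w
returnsToZero⇒Balanced w r =
  ℤ.+-injective (ℤ.i-j≡0⇒i≡j (+ length (upMarks w)) (+ length (downMarks false w))
    (trans (ℤ.m-n≡m⊖n (length (upMarks w)) (length (downMarks false w))) (proj₁ (returnsToZero⇔netRise≡0 w) r)))

Balanced⇒returnsToZero : ∀ w → Balanced w → returnsToZero w ≡ true
Balanced⇒returnsToZero w b =
  proj₂ (returnsToZero⇔netRise≡0 w) (trans (cong (_⊖ downs) b) (ℤ.n⊖n≡0 downs))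
  where downs = length (downMarks false w)

bit≤ : Bool → ℤ → Bool
bit≤ false (+ _)     = true
bit≤ false -[1+ _ ]  = false
bit≤ true  (+ suc _) = true
bit≤ true  _         = false

shift : ℤ → Bool → Bool → ℤ
shift z false false = z
shift z true  true  = z
shift z true  false = z +ℤ + 1
shift z false true  = z +ℤ -[1+ 0 ]

-- The i-th up step is under the axis iff the i-th down step comes first. With z the number of
-- ones among the first i - 1 up-marks minus that among the first i - 1 down-marks, this
-- happens iff bit tᵢ ≤ z for the i-th down-mark tᵢ, because runs of up and down steps
-- alternate and the ones count how many runs have been completed.
underCount : ℤ → List Bool → List Bool → ℕ
underCount z (s ∷ ss) (t ∷ ts) = bit (bit≤ t z) + underCount (shift z s t) ss ts
underCount _ _        _        = 0

-[1+k]+1≡-k : ∀ k → -[1+ k ] +ℤ + 1 ≡ - (+ k)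
-[1+k]+1≡-k zero    = refl
-[1+k]+1≡-k (suc k) = refl

-k-1≡-[1+k] : ∀ k → - (+ k) +ℤ -[1+ 0 ] ≡ -[1+ k ]
-k-1≡-[1+k] zero    = refl
-k-1≡-[1+k] (suc k) = cong -[1+_] (cong suc (+-identityʳ k))

underUps-D : ∀ h w → underUps h (D ∷ w) ≡ underUps (h +ℤ -[1+ 0 ]) w
underUps-D (+ _)    _ = refl
underUps-D -[1+ _ ] _ = refl

lastUpMark : Bool → List Step → Bool
lastUpMark true  w = startsWithD w
lastUpMark false _ = true

shift-matched : ∀ t s x → shift (+ (bit t + x + 0)) s t ≡ + (x + bit s)
shift-matched false false x = cong +_ (trans (+-identityʳ x) (sym (+-identityʳ x)))
shift-matched true  true  x = cong +_ (trans (cong suc (+-identityʳ x)) (+-comm 1 x))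
shift-matched true  false x = refl
shift-matched false true  x = cong +_ (cong (_+ 1) (+-identityʳ x))

bit≤-matched : ∀ t x → bit (bit≤ t (+ (bit t + x + 0))) ≡ 1
bit≤-matched false _ = refl
bit≤-matched true  _ = refl

bit≤-unmatched : ∀ t s x → bit≤ t (- (+ (bit s + x + bit (not t)))) ≡ false
bit≤-unmatched true  true  _       = refl
bit≤-unmatched true  false zero    = refl
bit≤-unmatched true  false (suc _) = refl
bit≤-unmatched false true  _       = refl
bit≤-unmatched false false x rewrite +-comm x 1 = refl

shift-unmatched : ∀ t s x → shift (- (+ (bit s + x + bit (not t)))) s t ≡ - (+ (x + 1))
shift-unmatched true  true  x       rewrite +-identityʳ x | +-comm x 1 = refl
shift-unmatched true  false zero    = refl
shift-unmatched true  false (suc x) = cong -[1+_] (trans (cong suc (trans (+-identityʳ _) (+-identityʳ x))) (+-comm 1 x))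
shift-unmatched false true  x       rewrite +-comm x 1 = refl
shift-unmatched false false _       = refl

-- Match the i-th down step with the i-th up step. After a prefix ending at height -|ds| ≤ 0,
-- ds are the marks of the unmatched down steps; after a prefix ending at height 1 + |us|, the
-- unmatched up steps have marks us ++ [lastUpMark afterU w] (the last up step of a prefix
-- ending in D is followed by D). In both cases the first argument of underCount is the value
-- of z at the next comparison.
mutual
  underUps-atOrBelow : ∀ w afterU ds →
    underUps (- (+ length ds)) w
      ≡ underCount (+ (trues ds + bit (afterU ∧ startsWithD w))) (upMarks w) (ds ++ downMarks afterU w)
  underUps-atOrBelow []      _      []      = refl
  underUps-atOrBelow []      _      (_ ∷ _) = refl
  underUps-atOrBelow (D ∷ w) afterU ds      = begin
    underUps (- (+ length ds)) (D ∷ w)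
      ≡⟨ underUps-D (- (+ length ds)) w ⟩
    underUps (- (+ length ds) +ℤ -[1+ 0 ]) w
      ≡⟨ cong (λ h → underUps h w) (-k-1≡-[1+k] (length ds)) ⟩
    underUps (- (+ suc (length ds))) w
      ≡⟨ cong (λ k → underUps (- (+ k)) w) (trans (+-comm 1 (length ds)) (sym (length-++ ds))) ⟩
    underUps (- (+ length (ds ++ afterU ∷ []))) w
      ≡⟨ underUps-atOrBelow w false (ds ++ afterU ∷ []) ⟩
    underCount (+ (trues (ds ++ afterU ∷ []) + 0)) (upMarks w) ((ds ++ afterU ∷ []) ++ downMarks false w)
      ≡⟨ cong₂ (λ a ts → underCount (+ a) (upMarks w) ts)
               (trans (+-identityʳ _) (trues-∷ʳ ds afterU)) (++-assoc ds (afterU ∷ []) (downMarks false w)) ⟩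
    underCount (+ (trues ds + bit afterU)) (upMarks w) (ds ++ afterU ∷ downMarks false w)
      ≡⟨ cong (λ b → underCount (+ (trues ds + bit b)) (upMarks w) (ds ++ afterU ∷ downMarks false w))
              (∧-identityʳ afterU) ⟨
    underCount (+ (trues ds + bit (afterU ∧ true))) (upMarks w) (ds ++ afterU ∷ downMarks false w) ∎
    where open ≡-Reasoning
  underUps-atOrBelow (U ∷ w) true  []       = underUps-above w true []
  underUps-atOrBelow (U ∷ w) false []       = underUps-above w true []
  underUps-atOrBelow (U ∷ w) afterU (t ∷ ds) rewrite ∧-zeroʳ afterU =
    trans (cong (λ h → suc (underUps h w)) (-[1+k]+1≡-k (length ds)))
          (trans (cong suc (underUps-atOrBelow w true ds)) (matched t (startsWithD w)))
    where
    matched : ∀ t s → suc (underCount (+ (trues ds + bit s)) (upMarks w) (ds ++ downMarks true w))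
                    ≡ underCount (+ (bit t + trues ds + 0)) (s ∷ upMarks w) (t ∷ ds ++ downMarks true w)
    matched t s rewrite shift-matched t s (trues ds) | bit≤-matched t (trues ds) = refl

  underUps-above : ∀ w afterU us →
    underUps (+ suc (length us)) w
      ≡ underCount (- (+ (trues us + bit (not afterU)))) ((us ++ lastUpMark afterU w ∷ []) ++ upMarks w) (downMarks afterU w)
  underUps-above [] afterU us = sym (underCount-[] _ ((us ++ lastUpMark afterU [] ∷ []) ++ []))
    where
    underCount-[] : ∀ z ss → underCount z ss [] ≡ 0
    underCount-[] _ []      = refl
    underCount-[] _ (_ ∷ _) = refl
  underUps-above (U ∷ w) afterU us = begin
    underUps (+ suc (length us) +ℤ + 1) w
      ≡⟨ cong (λ k → underUps (+ suc k) w) (sym (length-++ us)) ⟩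
    underUps (+ suc (length (us ++ u ∷ []))) w
      ≡⟨ underUps-above w true (us ++ u ∷ []) ⟩
    underCount (- (+ (trues (us ++ u ∷ []) + 0))) (((us ++ u ∷ []) ++ startsWithD w ∷ []) ++ upMarks w) (downMarks true w)
      ≡⟨ cong₂ (λ a ss → underCount (- (+ a)) ss (downMarks true w))
               (trans (+-identityʳ _) (trans (trues-∷ʳ us u) (cong (_+_ (trues us)) (bit-lastUpMark afterU))))
               (++-assoc (us ++ u ∷ []) (startsWithD w ∷ []) (upMarks w)) ⟩
    underCount (- (+ (trues us + bit (not afterU)))) ((us ++ u ∷ []) ++ upMarks (U ∷ w)) (downMarks true w) ∎
    where
    open ≡-Reasoning
    u = lastUpMark afterU (U ∷ w)
    bit-lastUpMark : ∀ afterU → bit (lastUpMark afterU (U ∷ w)) ≡ bit (not afterU)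
    bit-lastUpMark true  = refl
    bit-lastUpMark false = refl
  underUps-above (D ∷ w) true  []       = underUps-atOrBelow w false []
  underUps-above (D ∷ w) false []       = underUps-atOrBelow w false []
  underUps-above (D ∷ w) true  (u ∷ us)
    rewrite bit≤-unmatched true u (trues us) | shift-unmatched true u (trues us) = underUps-above w false us
  underUps-above (D ∷ w) false (u ∷ us)
    rewrite bit≤-unmatched false u (trues us) | shift-unmatched false u (trues us) = underUps-above w false us

underUps≡underCount : ∀ w → underUps (+ 0) w ≡ underCount (+ 0) (upMarks w) (downMarks false w)
underUps≡underCount w = underUps-atOrBelow w false []

bit≤-complement : ∀ t z → bit (bit≤ (not t) (- z)) + bit (bit≤ t z) ≡ 1
bit≤-complement false (+ zero)  = refl
bit≤-complement false (+ suc _) = refl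
bit≤-complement false -[1+ _ ]  = refl
bit≤-complement true  (+ zero)  = refl
bit≤-complement true  (+ suc _) = refl
bit≤-complement true  -[1+ _ ]  = refl

shift-complement : ∀ z s t → shift (- z) (not s) (not t) ≡ - shift z s t
shift-complement z false false = refl
shift-complement z true  true  = refl
shift-complement z true  false = sym (ℤ.neg-distrib-+ z (+ 1))
shift-complement z false true  = sym (ℤ.neg-distrib-+ z -[1+ 0 ])

underCount-complement : ∀ z ss ts → length ss ≡ length ts →
  underCount (- z) (map not ss) (map not ts) + underCount z ss ts ≡ length ss
underCount-complement z []       []       _ = refl
underCount-complement z (s ∷ ss) (t ∷ ts) e = begin
  bit (bit≤ (not t) (- z)) + underCount (shift (- z) (not s) (not t)) (map not ss) (map not ts)
    + (bit (bit≤ t z) + underCount (shift z s t) ss ts)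
    ≡⟨ cong (λ z′ → bit (bit≤ (not t) (- z)) + underCount z′ (map not ss) (map not ts)
                      + (bit (bit≤ t z) + underCount (shift z s t) ss ts)) (shift-complement z s t) ⟩
  bit (bit≤ (not t) (- z)) + underCount (- shift z s t) (map not ss) (map not ts)
    + (bit (bit≤ t z) + underCount (shift z s t) ss ts)
    ≡⟨ interchange +-commutativeSemigroup (bit (bit≤ (not t) (- z))) _ (bit (bit≤ t z)) _ ⟩
  (bit (bit≤ (not t) (- z)) + bit (bit≤ t z))
    + (underCount (- shift z s t) (map not ss) (map not ts) + underCount (shift z s t) ss ts)
    ≡⟨ cong₂ _+_ (bit≤-complement t z) (underCount-complement (shift z s t) ss ts (suc-injective e)) ⟩
  suc (length ss) ∎
  where open ≡-Reasoning

complementPath : List Step → List Step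
complementPath w = decode (map not (upMarks w)) (map not (downMarks false w))

marks-complementPath : ∀ w → Balanced w →
  upMarks (complementPath w) ≡ map not (upMarks w) × downMarks false (complementPath w) ≡ map not (downMarks false w)
marks-complementPath w b = marks-decode (map not ss) (map not ts) (+-cancelʳ-≡ _ _ _ (begin
  trues (map not ss) + trues ss   ≡⟨ trues-map-not ss ⟩
  length ss                       ≡⟨ b ⟩
  length ts                       ≡⟨ trues-map-not ts ⟨
  trues (map not ts) + trues ts   ≡⟨ cong (_+_ (trues (map not ts))) (trues-upMarks≡trues-downMarks w) ⟨
  trues (map not ts) + trues ss   ∎))
  where
  open ≡-Reasoning
  ss = upMarks w
  ts = downMarks false w

Balanced-complementPath : ∀ w → Balanced w → Balanced (complementPath w)
Balanced-complementPath w b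
  rewrite proj₁ (marks-complementPath w b) | proj₂ (marks-complementPath w b)
        | length-map not (upMarks w) | length-map not (downMarks false w) = b

complementPath-involutive : ∀ w → Balanced w → complementPath (complementPath w) ≡ w
complementPath-involutive w b
  rewrite proj₁ (marks-complementPath w b) | proj₂ (marks-complementPath w b)
        | map-not-involutive (upMarks w) | map-not-involutive (downMarks false w) = decode-marks w

length-complementPath : ∀ w → Balanced w → length (complementPath w) ≡ length w
length-complementPath w b = begin
  length (complementPath w)
    ≡⟨ length≡length-upMarks+length-downMarks false (complementPath w) ⟩
  length (upMarks (complementPath w)) + length (downMarks false (complementPath w))
    ≡⟨ cong₂ (λ ss ts → length ss + length ts)
             (proj₁ (marks-complementPath w b)) (proj₂ (marks-complementPath w b)) ⟩
  length (map not (upMarks w)) + length (map not (downMarks false w))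
    ≡⟨ cong₂ _+_ (length-map not (upMarks w)) (length-map not (downMarks false w)) ⟩
  length (upMarks w) + length (downMarks false w)
    ≡⟨ length≡length-upMarks+length-downMarks false w ⟨
  length w ∎
  where open ≡-Reasoning

peaks-complementPath : ∀ w → Balanced w → peaks (complementPath w) + peaks w ≡ length (upMarks w)
peaks-complementPath w b = begin
  peaks (complementPath w) + peaks w
    ≡⟨ cong₂ _+_ (peaks≡trues-upMarks (complementPath w)) (peaks≡trues-upMarks w) ⟩
  trues (upMarks (complementPath w)) + trues (upMarks w)
    ≡⟨ cong (λ ss → trues ss + trues (upMarks w)) (proj₁ (marks-complementPath w b)) ⟩
  trues (map not (upMarks w)) + trues (upMarks w)
    ≡⟨ trues-map-not (upMarks w) ⟩
  length (upMarks w) ∎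
  where open ≡-Reasoning

underUps-complementPath : ∀ w → Balanced w → underUps (+ 0) (complementPath w) + underUps (+ 0) w ≡ length (upMarks w)
underUps-complementPath w b = begin
  underUps (+ 0) (complementPath w) + underUps (+ 0) w
    ≡⟨ cong₂ _+_ (underUps≡underCount (complementPath w)) (underUps≡underCount w) ⟩
  underCount (+ 0) (upMarks (complementPath w)) (downMarks false (complementPath w))
    + underCount (+ 0) (upMarks w) (downMarks false w)
    ≡⟨ cong₂ (λ ss ts → underCount (+ 0) ss ts + underCount (+ 0) (upMarks w) (downMarks false w))
             (proj₁ (marks-complementPath w b)) (proj₂ (marks-complementPath w b)) ⟩
  underCount (+ 0) (map not (upMarks w)) (map not (downMarks false w))
    + underCount (+ 0) (upMarks w) (downMarks false w)
    ≡⟨ underCount-complement (+ 0) (upMarks w) (downMarks false w) b ⟩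
  length (upMarks w) ∎
  where open ≡-Reasoning

-- Extended by the identity to unbalanced words, so as to be an involution of all words.
flipPath : List Step → List Step
flipPath w with length (upMarks w) ≟ length (downMarks false w)
... | yes _ = complementPath w
... | no  _ = w

flipPath-Balanced : ∀ w → Balanced w → flipPath w ≡ complementPath w
flipPath-Balanced w b with length (upMarks w) ≟ length (downMarks false w)
... | yes _ = refl
... | no ¬b = contradiction b ¬b

flipPath-¬Balanced : ∀ w → ¬ Balanced w → flipPath w ≡ w
flipPath-¬Balanced w ¬b with length (upMarks w) ≟ length (downMarks false w)
... | yes b = contradiction b ¬b
... | no  _ = refl

flipPath-involutive : ∀ w → flipPath (flipPath w) ≡ w
flipPath-involutive w with length (upMarks w) ≟ length (downMarks false w)
... | yes b = trans (flipPath-Balanced (complementPath w) (Balanced-complementPath w b)) (complementPath-involutive w b)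
... | no ¬b = flipPath-¬Balanced w ¬b

length-≡-by-involution : ∀ {A : Set} (f : A → A) → (∀ x → f (f x) ≡ x) → {xs ys : List A} →
  Unique xs → Unique ys → (∀ {x} → x ∈ xs → f x ∈ ys) → (∀ {y} → y ∈ ys → f y ∈ xs) →
  length xs ≡ length ys
length-≡-by-involution f f∘f≡id {xs} {ys} xs! ys! f[xs]⊆ys f[ys]⊆xs =
  trans (sym (length-map f xs))
        (↭-length (∼bag⇒↭ (unique∧set⇒bag (Unique.map⁺ f-injective xs!) ys! (mk⇔ to from))))
  where
  f-injective : ∀ {x y} → f x ≡ f y → x ≡ y
  f-injective {x} {y} e = trans (sym (f∘f≡id x)) (trans (cong f e) (f∘f≡id y))

  to : ∀ {y} → y ∈ map f xs → y ∈ ys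
  to y∈ with ∈-map⁻ f y∈
  ... | _ , x∈ , refl = f[xs]⊆ys x∈

  from : ∀ {y} → y ∈ ys → y ∈ map f xs
  from {y} y∈ = subst (_∈ map f xs) (f∘f≡id y) (∈-map⁺ f (f[ys]⊆xs y∈))

words-length : ∀ l {w} → w ∈ words l → length w ≡ l
words-length zero    (here refl) = refl
words-length (suc l) w∈ with ∈-++⁻ (map (U ∷_) (words l)) w∈
... | inj₁ w∈U with ∈-map⁻ (U ∷_) w∈U
...   | v , v∈ , refl = cong suc (words-length l v∈)
words-length (suc l) w∈ | inj₂ w∈D with ∈-map⁻ (D ∷_) w∈D
...   | v , v∈ , refl = cong suc (words-length l v∈)

∈-words : ∀ w → w ∈ words (length w)
∈-words []      = here refl
∈-words (U ∷ w) = ∈-++⁺ˡ (∈-map⁺ (U ∷_) (∈-words w))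
∈-words (D ∷ w) = ∈-++⁺ʳ (map (U ∷_) (words (length w))) (∈-map⁺ (D ∷_) (∈-words w))

words-unique : ∀ l → Unique (words l)
words-unique zero    = [] ∷ []
words-unique (suc l) =
  Unique.++⁺ (Unique.map⁺ ∷-injectiveʳ (words-unique l)) (Unique.map⁺ ∷-injectiveʳ (words-unique l)) disjoint
  where
  disjoint : ∀ {w} → ¬ (w ∈ map (U ∷_) (words l) × w ∈ map (D ∷_) (words l))
  disjoint (w∈U , w∈D) with ∈-map⁻ (U ∷_) w∈U | ∈-map⁻ (D ∷_) w∈D
  ... | _ , _ , refl | _ , _ , ()

Flawed : ℕ → ℕ → ℕ → List Step → Set
Flawed n m k w = length w ≡ n + n × returnsToZero w ≡ true × peaks w ≡ k × underUps (+ 0) w ≡ m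

flawedPaths : ℕ → ℕ → ℕ → List (List Step)
flawedPaths n m k = filter (λ w → underUps (+ 0) w ≟ m) (filter (λ w → peaks w ≟ k) (dyckPaths n))

∈-flawedPaths⁻ : ∀ n m k {w} → w ∈ flawedPaths n m k → Flawed n m k w
∈-flawedPaths⁻ n m k w∈ with ∈-filter⁻ (λ w → underUps (+ 0) w ≟ m) w∈
... | w∈₁ , under with ∈-filter⁻ (λ w → peaks w ≟ k) w∈₁
... | w∈₂ , pk with ∈-filter⁻ (λ w → returnsToZero w ≟ᵇ true) w∈₂
... | w∈₃ , r = words-length (n + n) w∈₃ , r , pk , under

∈-flawedPaths⁺ : ∀ n m k {w} → Flawed n m k w → w ∈ flawedPaths n m k
∈-flawedPaths⁺ n m k {w} (len , r , pk , under) =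
  ∈-filter⁺ (λ w → underUps (+ 0) w ≟ m)
    (∈-filter⁺ (λ w → peaks w ≟ k)
      (∈-filter⁺ (λ w → returnsToZero w ≟ᵇ true) (subst (λ l → w ∈ words l) len (∈-words w)) r) pk) under

flawedPaths-unique : ∀ n m k → Unique (flawedPaths n m k)
flawedPaths-unique n m k =
  Unique.filter⁺ (λ w → underUps (+ 0) w ≟ m) (Unique.filter⁺ (λ w → peaks w ≟ k)
    (Unique.filter⁺ (λ w → returnsToZero w ≟ᵇ true) (words-unique (n + n))))

+-double-injective : ∀ a n → a + a ≡ n + n → a ≡ n
+-double-injective zero    zero    _  = refl
+-double-injective (suc a) (suc n) e =
  cong suc (+-double-injective a n (suc-injective (trans (sym (+-suc a a)) (trans (suc-injective e) (+-suc n n)))))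

complementPath-Flawed : ∀ n m k w → Flawed n m k w → Flawed n (n ∸ m) (n ∸ k) (complementPath w)
complementPath-Flawed n m k w (len , r , pk , under) =
    trans (length-complementPath w balanced) len
  , Balanced⇒returnsToZero (complementPath w) (Balanced-complementPath w balanced)
  , ≡-∸ (trans (peaks-complementPath w balanced) semilength) pk
  , ≡-∸ (trans (underUps-complementPath w balanced) semilength) under
  where
  balanced : Balanced w
  balanced = returnsToZero⇒Balanced w r

  semilength : length (upMarks w) ≡ n
  semilength = +-double-injective (length (upMarks w)) n
    (trans (cong (_+_ (length (upMarks w))) balanced)
           (trans (sym (length≡length-upMarks+length-downMarks false w)) len))

  ≡-∸ : ∀ {x y z} → x + y ≡ n → y ≡ z → x ≡ n ∸ z
  ≡-∸ {x} {y} e refl = trans (sym (m+n∸n≡m x y)) (cong (_∸ y) e)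

flipPath-Flawed : ∀ n m k w → Flawed n m k w → Flawed n (n ∸ m) (n ∸ k) (flipPath w)
flipPath-Flawed n m k w flawed@(_ , r , _) =
  subst (Flawed n (n ∸ m) (n ∸ k)) (sym (flipPath-Balanced w (returnsToZero⇒Balanced w r)))
        (complementPath-Flawed n m k w flawed)

flipPath-∈-flawedPaths : ∀ n m k {w} → w ∈ flawedPaths n m k → flipPath w ∈ flawedPaths n (n ∸ m) (n ∸ k)
flipPath-∈-flawedPaths n m k {w} w∈ =
  ∈-flawedPaths⁺ n (n ∸ m) (n ∸ k) (flipPath-Flawed n m k w (∈-flawedPaths⁻ n m k w∈))

theorem2p2 : (n m k : ℕ) → 1 ≤ n → m ≤ n → k ≤ n → p n m k ≡ p n (n ∸ m) (n ∸ k)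
theorem2p2 n m k _ m≤n k≤n =
  length-≡-by-involution flipPath flipPath-involutive
    (flawedPaths-unique n m k) (flawedPaths-unique n (n ∸ m) (n ∸ k))
    (flipPath-∈-flawedPaths n m k)
    (λ {w} w∈ → subst₂ (λ m′ k′ → flipPath w ∈ flawedPaths n m′ k′) (m∸[m∸n]≡n m≤n) (m∸[m∸n]≡n k≤n)
                       (flipPath-∈-flawedPaths n (n ∸ m) (n ∸ k) w∈))
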